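{- The reduction $\to$ is confluent on typed terms: for every typed term $M$, if $M\to^* N$ and $M\to^* P$, then there is a term $Q$ with $N\to^* Q$ and $P\to^* Q$.
   Context: Types: type expressions are generated by $\sigma ::= t \mid \sigma+\sigma \mid \sigma\times\sigma\mid \sigma\to\sigma\mid \mu t.\sigma\mid \mathrm{void}$ ($t$ type variables); types are closed type expressions. Simple types: $\tau::=\mathrm{void}\mid\tau+\tau\mid\tau\times\tau\mid\tau\to\tau$. The prefix relation $\preceq$ is the least relation with $\mathrm{void}\preceq\tau$ for all types $\tau$ and $\sigma\preceq\sigma',\tau\preceq\tau'\Rightarrow\sigma\star\tau\preceq\sigma'\star\tau'$ ($\star\in\{+,\times,\to\}$, $\sigma,\tau$ simple). Unfolding $\rhd$: least relation with $\mu t.\tau\rhd\tau[\mu t.\tau/t]$, closed under $\star$ in either argument; $\rhd^*$ its reflexive transitive closure; $\tau\!\uparrow=\{\sigma\text{ simple}\mid\exists\tau'(\tau\rhd^*\tau',\sigma\preceq\tau')\}$; $\sigma\approx\tau$ iff $\sigma\!\uparrow=\tau\!\uparrow$. Terms: for each type $\sigma$ there is a countable set of variables $x^\sigma$. Constants, for all types $\sigma,\tau,\rho$ ($\to$ associates to the right): $0_{\sigma,\tau}:\sigma\to(\sigma+\tau)$, $1_{\sigma,\tau}:\tau\to(\sigma+\tau)$, $\mathrm{case}_{\sigma,\tau,\rho}:(\sigma+\tau)\to(\sigma\to\rho)\to(\tau\to\rho)\to\rho$, $\mathrm{pcase}_{\sigma,\tau,\rho}:(\sigma+\tau)\to\rho\to\rho\to\rho$,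 $\mathrm{pair}_{\sigma,\tau}:\sigma\to\tau\to(\sigma\times\tau)$, $\mathrm{fst}_{\sigma,\tau}:(\sigma\times\tau)\to\sigma$, $\mathrm{snd}_{\sigma,\tau}:(\sigma\times\tau)\to\tau$, $\Omega_\sigma:\sigma$. Typing rules: each constant has its given type; $x^\sigma:\sigma$; if $M:\tau$ then $\lambda x^\sigma.M:\sigma\to\tau$; if $M:\sigma\to\tau$ and $N:\sigma$ then $MN:\tau$; if $M:\sigma$ and $\sigma\approx\tau$ then $M:\tau$. A typed term is one derivable by these rules. Terms are identified up to $\alpha$-conversion; $(M,N)$ abbreviates $\mathrm{pair}\,M\,N$. Reduction: $\to$ is the least relation on terms containing $(\lambda x.M)N\to M[x:=N]$ (capture-avoiding substitution), closed under contexts ($M\to M'$ implies $MN\to M'N$, $NM\to NM'$ and $\lambda x.M\to\lambda x.M'$), and containing the following rules, where $x,y,z,w,y_i,z_i$ stand for arbitrary terms: $\mathrm{case}\,(0x)\,y\,z\to y\,x$; $\mathrm{case}\,(1x)\,y\,z\to z\,x$; $\mathrm{fst}\,(x,y)\to x$; $\mathrm{snd}\,(x,y)\to y$; $\mathrm{pcase}\,(0x)\,y\,z\to y$; $\mathrm{pcase}\,(1x)\,y\,z\to z$; $\mathrm{pcase}_{\sigma,\tau,\rho_0+\rho_1}\,x\,(0y)\,(0z)\to 0\,(\mathrm{pcase}_{\sigma,\tau,\rho_0}\,x\,y\,z)$; $\mathrm{pcase}_{\sigma,\tau,\rho_0+\rho_1}\,x\,(1y)\,(1z)\to 1\,(\mathrm{pcase}_{\sigma,\tau,\rho_1}\,x\,y\,z)$;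 $\mathrm{pcase}_{\sigma,\tau,\rho_1\times\rho_2}\,x\,(y_1,y_2)\,(z_1,z_2)\to(\mathrm{pcase}_{\sigma,\tau,\rho_1}\,x\,y_1\,z_1,\ \mathrm{pcase}_{\sigma,\tau,\rho_2}\,x\,y_2\,z_2)$; $(\mathrm{pcase}_{\sigma,\tau,\rho_1\to\rho_2}\,x\,y\,z)\,w\to\mathrm{pcase}_{\sigma,\tau,\rho_2}\,x\,(y\,w)\,(z\,w)$. $\to^*$ is the reflexive transitive closure of $\to$. -}

module Defs where

open import Data.Nat using (ℕ; zero; suc; _≡ᵇ_; _<ᵇ_; pred)
open import Data.Bool using (Bool; true; false; if_then_else_)
open import Data.List using (List; []; _∷_)
open import Data.List.Membership.Propositional using (_∈_)
open import Data.Product using (Σ; _×_; ∃; ∃-syntax; _,_)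
open import Relation.Binary.PropositionalEquality using (_≡_)
open import Relation.Binary.Construct.Closure.ReflexiveTransitive using (Star)

infixr 7 _⇒_
infixr 8 _⊕_
infixr 9 _⊗_

data TyExp : Set where
  tvar : ℕ → TyExp
  _⊕_  : TyExp → TyExp → TyExp
  _⊗_  : TyExp → TyExp → TyExp
  _⇒_  : TyExp → TyExp → TyExp
  μ    : ℕ → TyExp → TyExp
  void : TyExp

data Scoped (bs : List ℕ) : TyExp → Set where
  tvar : ∀ {t} → t ∈ bs → Scoped bs (tvar t)
  _⊕_  : ∀ {σ τ} → Scoped bs σ → Scoped bs τ → Scoped bs (σ ⊕ τ)
  _⊗_  : ∀ {σ τ} → Scoped bs σ → Scoped bs τ → Scoped bs (σ ⊗ τ)
  _⇒_  : ∀ {σ τ} → Scoped bs σ → Scoped bs τ → Scoped bs (σ ⇒ τ)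
  μ    : ∀ {t σ} → Scoped (t ∷ bs) σ → Scoped bs (μ t σ)
  void : Scoped bs void

Closed : TyExp → Set
Closed = Scoped []

-- Substitution  e[s/t]  (only ever used with closed s, so no capture).
tsub : ℕ → TyExp → TyExp → TyExp
tsub t s (tvar u) = if t ≡ᵇ u then s else tvar u
tsub t s (σ ⊕ τ) = tsub t s σ ⊕ tsub t s τ
tsub t s (σ ⊗ τ) = tsub t s σ ⊗ tsub t s τ
tsub t s (σ ⇒ τ) = tsub t s σ ⇒ tsub t s τ
tsub t s (μ u σ) = if t ≡ᵇ u then μ u σ else μ u (tsub t s σ)
tsub t s void = void

-- Prefix relation  σ ≼ τ  (the left side is necessarily simple:
-- it is built from void, +, ×, → only).
data _≼_ : TyExp → TyExp → Set where
  void≼ : ∀ {τ} → void ≼ τ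
  ⊕≼ : ∀ {σ τ σ' τ'} → σ ≼ σ' → τ ≼ τ' → (σ ⊕ τ) ≼ (σ' ⊕ τ')
  ⊗≼ : ∀ {σ τ σ' τ'} → σ ≼ σ' → τ ≼ τ' → (σ ⊗ τ) ≼ (σ' ⊗ τ')
  ⇒≼ : ∀ {σ τ σ' τ'} → σ ≼ σ' → τ ≼ τ' → (σ ⇒ τ) ≼ (σ' ⇒ τ')

data _▷_ : TyExp → TyExp → Set where
  unfold : ∀ {t τ} → μ t τ ▷ tsub t (μ t τ) τ
  ⊕ˡ : ∀ {σ σ' τ} → σ ▷ σ' → (σ ⊕ τ) ▷ (σ' ⊕ τ)
  ⊕ʳ : ∀ {σ τ τ'} → τ ▷ τ' → (σ ⊕ τ) ▷ (σ ⊕ τ')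
  ⊗ˡ : ∀ {σ σ' τ} → σ ▷ σ' → (σ ⊗ τ) ▷ (σ' ⊗ τ)
  ⊗ʳ : ∀ {σ τ τ'} → τ ▷ τ' → (σ ⊗ τ) ▷ (σ ⊗ τ')
  ⇒ˡ : ∀ {σ σ' τ} → σ ▷ σ' → (σ ⇒ τ) ▷ (σ' ⇒ τ)
  ⇒ʳ : ∀ {σ τ τ'} → τ ▷ τ' → (σ ⇒ τ) ▷ (σ ⇒ τ')

_▷*_ : TyExp → TyExp → Set
_▷*_ = Star _▷_

-- σ ∈ τ↑  iff  ∃ τ' (τ ▷* τ' and σ ≼ τ')   (σ simple is forced by ≼)
_∈↑_ : TyExp → TyExp → Set
σ ∈↑ τ = ∃[ τ' ] (τ ▷* τ' × σ ≼ τ')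

_≈_ : TyExp → TyExp → Set
σ ≈ τ = ∀ ρ → ((ρ ∈↑ σ → ρ ∈↑ τ) × (ρ ∈↑ τ → ρ ∈↑ σ))

-- Terms.  Free variables are named and typed (x^σ = fv σ n);
-- bound variables use de Bruijn indices (so α-equivalent terms are equal).

data Const : Set where
  c0 c1 : TyExp → TyExp → Const
  case pcase : TyExp → TyExp → TyExp → Const
  pair fst snd : TyExp → TyExp → Const
  Ω : TyExp → Const

data Tm : Set where
  fv  : TyExp → ℕ → Tm
  bv  : ℕ → Tm
  con : Const → Tm
  app : Tm → Tm → Tm
  lam : TyExp → Tm → Tm

shift : ℕ → Tm → Tm
shift c (fv σ n) = fv σ n
shift c (bv i) = if i <ᵇ c then bv i else bv (suc i)
shift c (con k) = con k
shift c (app M N) = app (shift c M) (shift c N)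
shift c (lam σ M) = lam σ (shift (suc c) M)

subst : ℕ → Tm → Tm → Tm
subst k N (fv σ n) = fv σ n
subst k N (bv i) = if i <ᵇ k then bv i else (if i ≡ᵇ k then N else bv (pred i))
subst k N (con c) = con c
subst k N (app M M') = app (subst k N M) (subst k N M')
subst k N (lam σ M) = lam σ (subst (suc k) (shift 0 N) M)

app2 : Tm → Tm → Tm → Tm
app2 f a b = app (app f a) b

app3 : Tm → Tm → Tm → Tm → Tm
app3 f a b c = app (app (app f a) b) c

-- Typing (Γ lists the types of the de Bruijn-bound variables).

data _∋_∶_ : List TyExp → ℕ → TyExp → Set where
  here  : ∀ {Γ σ} → (σ ∷ Γ) ∋ zero ∶ σ
  there : ∀ {Γ σ τ i} → Γ ∋ i ∶ σ → (τ ∷ Γ) ∋ suc i ∶ σ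

data ConstType : Const → TyExp → Set where
  t0 : ∀ {σ τ} → Closed σ → Closed τ → ConstType (c0 σ τ) (σ ⇒ (σ ⊕ τ))
  t1 : ∀ {σ τ} → Closed σ → Closed τ → ConstType (c1 σ τ) (τ ⇒ (σ ⊕ τ))
  tcase : ∀ {σ τ ρ} → Closed σ → Closed τ → Closed ρ →
    ConstType (case σ τ ρ) ((σ ⊕ τ) ⇒ (σ ⇒ ρ) ⇒ (τ ⇒ ρ) ⇒ ρ)
  tpcase : ∀ {σ τ ρ} → Closed σ → Closed τ → Closed ρ →
    ConstType (pcase σ τ ρ) ((σ ⊕ τ) ⇒ ρ ⇒ ρ ⇒ ρ)
  tpair : ∀ {σ τ} → Closed σ → Closed τ → ConstType (pair σ τ) (σ ⇒ τ ⇒ (σ ⊗ τ))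
  tfst : ∀ {σ τ} → Closed σ → Closed τ → ConstType (fst σ τ) ((σ ⊗ τ) ⇒ σ)
  tsnd : ∀ {σ τ} → Closed σ → Closed τ → ConstType (snd σ τ) ((σ ⊗ τ) ⇒ τ)
  tΩ : ∀ {σ} → Closed σ → ConstType (Ω σ) σ

data _⊢_∶_ (Γ : List TyExp) : Tm → TyExp → Set where
  tfv  : ∀ {σ n} → Closed σ → Γ ⊢ fv σ n ∶ σ
  tbv  : ∀ {σ i} → Γ ∋ i ∶ σ → Γ ⊢ bv i ∶ σ
  tcon : ∀ {c σ} → ConstType c σ → Γ ⊢ con c ∶ σ
  tlam : ∀ {σ τ M} → Closed σ → (σ ∷ Γ) ⊢ M ∶ τ → Γ ⊢ lam σ M ∶ (σ ⇒ τ)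
  tapp : ∀ {σ τ M N} → Γ ⊢ M ∶ (σ ⇒ τ) → Γ ⊢ N ∶ σ → Γ ⊢ app M N ∶ τ
  tconv : ∀ {σ τ M} → Γ ⊢ M ∶ σ → Closed τ → σ ≈ τ → Γ ⊢ M ∶ τ

Typed : Tm → Set
Typed M = ∃[ σ ] ([] ⊢ M ∶ σ)

infix 4 _⟶_ _⟶*_

data _⟶_ : Tm → Tm → Set where
  β : ∀ {σ M N} → app (lam σ M) N ⟶ subst 0 N M
  appˡ : ∀ {M M' N} → M ⟶ M' → app M N ⟶ app M' N
  appʳ : ∀ {M N N'} → N ⟶ N' → app M N ⟶ app M N'
  lamc : ∀ {σ M M'} → M ⟶ M' → lam σ M ⟶ lam σ M'
  case0 : ∀ {σ τ ρ a b x y z} →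
    app3 (con (case σ τ ρ)) (app (con (c0 a b)) x) y z ⟶ app y x
  case1 : ∀ {σ τ ρ a b x y z} →
    app3 (con (case σ τ ρ)) (app (con (c1 a b)) x) y z ⟶ app z x
  fstp : ∀ {σ τ a b x y} → app (con (fst σ τ)) (app2 (con (pair a b)) x y) ⟶ x
  sndp : ∀ {σ τ a b x y} → app (con (snd σ τ)) (app2 (con (pair a b)) x y) ⟶ y
  pcase0 : ∀ {σ τ ρ a b x y z} →
    app3 (con (pcase σ τ ρ)) (app (con (c0 a b)) x) y z ⟶ y
  pcase1 : ∀ {σ τ ρ a b x y z} →
    app3 (con (pcase σ τ ρ)) (app (con (c1 a b)) x) y z ⟶ z
  pcase⊕0 : ∀ {σ τ ρ₀ ρ₁ x y z} →
    app3 (con (pcase σ τ (ρ₀ ⊕ ρ₁))) x (app (con (c0 ρ₀ ρ₁)) y) (app (con (c0 ρ₀ ρ₁)) z)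
      ⟶ app (con (c0 ρ₀ ρ₁)) (app3 (con (pcase σ τ ρ₀)) x y z)
  pcase⊕1 : ∀ {σ τ ρ₀ ρ₁ x y z} →
    app3 (con (pcase σ τ (ρ₀ ⊕ ρ₁))) x (app (con (c1 ρ₀ ρ₁)) y) (app (con (c1 ρ₀ ρ₁)) z)
      ⟶ app (con (c1 ρ₀ ρ₁)) (app3 (con (pcase σ τ ρ₁)) x y z)
  pcase⊗ : ∀ {σ τ ρ₁ ρ₂ x y₁ y₂ z₁ z₂} →
    app3 (con (pcase σ τ (ρ₁ ⊗ ρ₂))) x
         (app2 (con (pair ρ₁ ρ₂)) y₁ y₂) (app2 (con (pair ρ₁ ρ₂)) z₁ z₂)
      ⟶ app2 (con (pair ρ₁ ρ₂)) (app3 (con (pcase σ τ ρ₁)) x y₁ z₁)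
                                (app3 (con (pcase σ τ ρ₂)) x y₂ z₂)
  pcase⇒ : ∀ {σ τ ρ₁ ρ₂ x y z w} →
    app (app3 (con (pcase σ τ (ρ₁ ⇒ ρ₂))) x y z) w
      ⟶ app3 (con (pcase σ τ ρ₂)) x (app y w) (app z w)

_⟶*_ : Tm → Tm → Set
_⟶*_ = Star _⟶_

-- The proof is the Tait–Martin-Löf method.  We introduce a parallel
-- reduction ⇛ that contracts any set of redexes simultaneously and satisfies
--   (1) ⟶ ⊆ ⇛ ⊆ ⟶*, so ⇛* and ⟶* coincide, and
--   (2) ⇛ has the diamond property.
-- An abstract argument (strip lemma) turns (2) into confluence of ⇛, and
-- (1) transfers confluence from ⇛ to ⟶.
--
-- The argument never uses types: ⟶ is confluent on all terms, typed or not.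

module Submission where

open import Defs
open import Data.Product using (_×_; ∃-syntax; _,_)
open import Data.Nat using (ℕ; zero; suc; _<ᵇ_; _≡ᵇ_; _<_; _≤_; z≤n; s≤s)
open import Data.Nat.Properties using (≤-<-connex; ≤-refl; ≤-trans; <-≤-trans; n≤1+n; m<n⇒m<1+n)
open import Data.Bool using (true; false)
open import Data.Sum using (inj₁; inj₂)
open import Level using (Level; _⊔_)
open import Relation.Binary.Core using (Rel)
open import Relation.Binary.PropositionalEquality using (_≡_; refl; sym; cong; cong₂; trans)
open import Relation.Binary.Construct.Closure.ReflexiveTransitive using (Star; ε; _◅_; _◅◅_; gmap; map; return; _⋆)
open import Relation.Binary.Rewriting using (Confluent)

module _ {a ℓ : Level} {A : Set a} where

  Joinable : Rel A ℓ → A → A → Set (a ⊔ ℓ)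
  Joinable _~_ b c = ∃[ d ] (b ~ d × c ~ d)

  Diamond : Rel A ℓ → Set (a ⊔ ℓ)
  Diamond _~_ = ∀ {x b c} → x ~ b → x ~ c → Joinable _~_ b c

  joinable-sym : ∀ {_~_ : Rel A ℓ} {b c} → Joinable _~_ b c → Joinable _~_ c b
  joinable-sym (d , bd , cd) = d , cd , bd

  module _ {_~_ : Rel A ℓ} (diamond : Diamond _~_) where

    strip : ∀ {x b c} → x ~ b → Star _~_ x c → ∃[ d ] (Star _~_ b d × c ~ d)
    strip xb ε = _ , ε , xb
    strip xb (xy ◅ yc) with diamond xb xy
    ... | d , bd , yd with strip yd yc
    ...   | e , de , ce = e , bd ◅ de , ce

    diamond⇒confluent : Confluent _~_
    diamond⇒confluent ε xc = _ , xc , ε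
    diamond⇒confluent (xy ◅ yb) xc with strip xy xc
    ... | d , yd , cd with diamond⇒confluent yb yd
    ...   | e , be , de = e , be , cd ◅ de

  -- Confluence is a property of the reflexive–transitive closure only, so
  -- it transfers from S to R whenever R ⊆ S ⊆ R*.
  confluent-between : ∀ {R S : Rel A ℓ} →
    (∀ {x y} → R x y → S x y) → (∀ {x y} → S x y → Star R x y) →
    Confluent S → Confluent R
  confluent-between R⊆S S⊆R* conf xb xc with conf (map R⊆S xb) (map R⊆S xc)
  ... | d , bd , cd = d , (S⊆R* ⋆) bd , (S⊆R* ⋆) cd

<ᵇ-true : ∀ {i c} → i < c → (i <ᵇ c) ≡ true
<ᵇ-true {zero} (s≤s _) = refl
<ᵇ-true {suc i} (s≤s i<c@(s≤s _)) = <ᵇ-true i<c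

<ᵇ-false : ∀ {i c} → c ≤ i → (i <ᵇ c) ≡ false
<ᵇ-false {c = zero} z≤n = refl
<ᵇ-false (s≤s c≤i) = <ᵇ-false c≤i

≡ᵇ-refl : ∀ i → (i ≡ᵇ i) ≡ true
≡ᵇ-refl zero = refl
≡ᵇ-refl (suc i) = ≡ᵇ-refl i

≡ᵇ-false : ∀ {k j} → k ≤ j → (suc j ≡ᵇ k) ≡ false
≡ᵇ-false {zero} _ = refl
≡ᵇ-false {suc k} (s≤s k≤j) = ≡ᵇ-false k≤j

shift-bv-< : ∀ {c i} → i < c → shift c (bv i) ≡ bv i
shift-bv-< i<c rewrite <ᵇ-true i<c = refl

shift-bv-≥ : ∀ {c i} → c ≤ i → shift c (bv i) ≡ bv (suc i)
shift-bv-≥ c≤i rewrite <ᵇ-false c≤i = refl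

subst-bv-< : ∀ {k i N} → i < k → subst k N (bv i) ≡ bv i
subst-bv-< i<k rewrite <ᵇ-true i<k = refl

subst-bv-≡ : ∀ {k N} → subst k N (bv k) ≡ N
subst-bv-≡ {k} rewrite <ᵇ-false (≤-refl {k}) | ≡ᵇ-refl k = refl

subst-bv-> : ∀ {k j N} → k ≤ j → subst k N (bv (suc j)) ≡ bv j
subst-bv-> {k} {j} k≤j rewrite <ᵇ-false {suc j} {k} (≤-trans k≤j (n≤1+n j)) | ≡ᵇ-false k≤j = refl

data Position (k : ℕ) : ℕ → Set where
  below : ∀ {i} → i < k → Position k i
  at    : Position k k
  above : ∀ {j} → k ≤ j → Position k (suc j)

position : ∀ k i → Position k i
position zero zero = at
position zero (suc j) = above z≤n
position (suc k) zero = below (s≤s z≤n)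
position (suc k) (suc i) with position k i
... | below i<k = below (s≤s i<k)
... | at = at
... | above k≤j = above (s≤s k≤j)

shift-shift : ∀ {c d} M → c ≤ d → shift (suc d) (shift c M) ≡ shift c (shift d M)
shift-shift (fv σ n) _ = refl
shift-shift {c} {d} (bv i) c≤d with ≤-<-connex c i
... | inj₂ i<c
  rewrite shift-bv-< {d} (<-≤-trans i<c c≤d) | shift-bv-< {c} i<c
        | shift-bv-< {suc d} (m<n⇒m<1+n (<-≤-trans i<c c≤d)) = refl
... | inj₁ c≤i with ≤-<-connex d i
...   | inj₂ i<d
  rewrite shift-bv-< {d} i<d | shift-bv-≥ {c} c≤i | shift-bv-< {suc d} (s≤s i<d) = refl
...   | inj₁ d≤i
  rewrite shift-bv-≥ {d} d≤i | shift-bv-≥ {c} c≤i | shift-bv-≥ {suc d} (s≤s d≤i)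
        | shift-bv-≥ {c} (≤-trans c≤i (n≤1+n i)) = refl
shift-shift (con k) _ = refl
shift-shift (app M N) c≤d = cong₂ app (shift-shift M c≤d) (shift-shift N c≤d)
shift-shift (lam σ M) c≤d = cong (lam σ) (shift-shift M (s≤s c≤d))

subst-shift : ∀ {c} X M → subst c X (shift c M) ≡ M
subst-shift X (fv σ n) = refl
subst-shift {c} X (bv i) with ≤-<-connex c i
... | inj₂ i<c rewrite shift-bv-< i<c | subst-bv-< {N = X} i<c = refl
... | inj₁ c≤i rewrite shift-bv-≥ c≤i | subst-bv-> {N = X} c≤i = refl
subst-shift X (con k) = refl
subst-shift X (app M N) = cong₂ app (subst-shift X M) (subst-shift X N)
subst-shift X (lam σ M) = cong (lam σ) (subst-shift (shift 0 X) M)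

shift-subst-above : ∀ {k c} N M → k ≤ c →
  shift c (subst k N M) ≡ subst k (shift c N) (shift (suc c) M)
shift-subst-above N (fv σ n) _ = refl
shift-subst-above {k} {c} N (bv i) k≤c with position k i
... | below i<k
  rewrite subst-bv-< {N = N} i<k | shift-bv-< {c} (<-≤-trans i<k k≤c)
        | shift-bv-< {suc c} (m<n⇒m<1+n (<-≤-trans i<k k≤c)) | subst-bv-< {N = shift c N} i<k = refl
... | at rewrite subst-bv-≡ {k} {N} | shift-bv-< {suc c} {k} (s≤s k≤c) | subst-bv-≡ {k} {shift c N} = refl
... | above {j} k≤j with ≤-<-connex c j
...   | inj₂ j<c
  rewrite subst-bv-> {N = N} k≤j | shift-bv-< j<c | shift-bv-< {suc c} (s≤s j<c)
        | subst-bv-> {N = shift c N} k≤j = refl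
...   | inj₁ c≤j
  rewrite subst-bv-> {N = N} k≤j | shift-bv-≥ c≤j | shift-bv-≥ {suc c} (s≤s c≤j)
        | subst-bv-> {N = shift c N} (≤-trans k≤j (n≤1+n j)) = refl
shift-subst-above N (con k) _ = refl
shift-subst-above N (app M M') k≤c = cong₂ app (shift-subst-above N M k≤c) (shift-subst-above N M' k≤c)
shift-subst-above {k} {c} N (lam σ M) k≤c = cong (lam σ) (trans
  (shift-subst-above (shift 0 N) M (s≤s k≤c))
  (cong (λ X → subst (suc k) X (shift (suc (suc c)) M)) (shift-shift N z≤n)))

shift-subst-below : ∀ {c k} N M → c ≤ k →
  shift c (subst k N M) ≡ subst (suc k) (shift c N) (shift c M)
shift-subst-below N (fv σ n) _ = refl
shift-subst-below {c} {k} N (bv i) c≤k with position k i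
... | below i<k with ≤-<-connex c i
...   | inj₂ i<c
  rewrite subst-bv-< {N = N} i<k | shift-bv-< i<c
        | subst-bv-< {suc k} {N = shift c N} (m<n⇒m<1+n i<k) = refl
...   | inj₁ c≤i
  rewrite subst-bv-< {N = N} i<k | shift-bv-≥ c≤i | subst-bv-< {suc k} {N = shift c N} (s≤s i<k) = refl
shift-subst-below {c} {k} N (bv i) c≤k | at
  rewrite subst-bv-≡ {k} {N} | shift-bv-≥ {c} {k} c≤k | subst-bv-≡ {suc k} {shift c N} = refl
shift-subst-below {c} {k} N (bv i) c≤k | above {j} k≤j
  rewrite subst-bv-> {N = N} k≤j | shift-bv-≥ {c} {j} (≤-trans c≤k k≤j)
        | shift-bv-≥ {c} {suc j} (≤-trans c≤k (≤-trans k≤j (n≤1+n j)))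
        | subst-bv-> {suc k} {N = shift c N} (s≤s k≤j) = refl
shift-subst-below N (con k) _ = refl
shift-subst-below N (app M M') c≤k = cong₂ app (shift-subst-below N M c≤k) (shift-subst-below N M' c≤k)
shift-subst-below {c} {k} N (lam σ M) c≤k = cong (lam σ) (trans
  (shift-subst-below (shift 0 N) M (s≤s c≤k))
  (cong (λ X → subst (suc (suc k)) X (shift (suc c) M)) (shift-shift N z≤n)))

subst-subst : ∀ {c k} N A M → c ≤ k →
  subst k N (subst c A M) ≡ subst c (subst k N A) (subst (suc k) (shift c N) M)
subst-subst N A (fv σ n) _ = refl
subst-subst {c} {k} N A (bv i) c≤k with position c i
... | below i<c
  rewrite subst-bv-< {N = A} i<c | subst-bv-< {N = N} (<-≤-trans i<c c≤k)
        | subst-bv-< {suc k} {N = shift c N} (m<n⇒m<1+n (<-≤-trans i<c c≤k))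
        | subst-bv-< {N = subst k N A} i<c = refl
... | at
  rewrite subst-bv-≡ {c} {A} | subst-bv-< {suc k} {c} {shift c N} (s≤s c≤k)
        | subst-bv-≡ {c} {subst k N A} = refl
... | above {j} c≤j with position k j
...   | below j<k
  rewrite subst-bv-> {N = A} c≤j | subst-bv-< {N = N} j<k
        | subst-bv-< {suc k} {N = shift c N} (s≤s j<k) | subst-bv-> {N = subst k N A} c≤j = refl
...   | at
  rewrite subst-bv-> {N = A} c≤j | subst-bv-≡ {k} {N} | subst-bv-≡ {suc k} {shift c N}
  = sym (subst-shift (subst k N A) N)
...   | above {l} k≤l
  rewrite subst-bv-> {N = A} c≤j | subst-bv-> {N = N} k≤l
        | subst-bv-> {suc k} {N = shift c N} (s≤s k≤l)
        | subst-bv-> {N = subst k N A} (≤-trans c≤k k≤l) = refl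
subst-subst N A (con k) _ = refl
subst-subst N A (app M M') c≤k = cong₂ app (subst-subst N A M c≤k) (subst-subst N A M' c≤k)
subst-subst {c} {k} N A (lam σ M) c≤k = cong (lam σ) (trans
  (subst-subst (shift 0 N) (shift 0 A) M (s≤s c≤k))
  (cong₂ (λ X Y → subst (suc c) X (subst (suc (suc k)) Y M))
         (sym (shift-subst-below N A z≤n)) (shift-shift N z≤n)))

variable
  σ τ ρ a b ρ₀ ρ₁ : TyExp
  M M' N N' x x' y y' z z' w w' y₁ y₁' y₂ y₂' z₁ z₁' z₂ z₂' : Tm

infix 4 _⇛_
data _⇛_ : Tm → Tm → Set where
  pfv  : ∀ {n} → fv σ n ⇛ fv σ n
  pbv  : ∀ {i} → bv i ⇛ bv i
  pcon : ∀ {c} → con c ⇛ con c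
  papp : M ⇛ M' → N ⇛ N' → app M N ⇛ app M' N'
  plam : M ⇛ M' → lam σ M ⇛ lam σ M'
  pβ   : M ⇛ M' → N ⇛ N' → app (lam σ M) N ⇛ subst 0 N' M'
  pca0 : x ⇛ x' → y ⇛ y' → app3 (con (case σ τ ρ)) (app (con (c0 a b)) x) y z ⇛ app y' x'
  pca1 : x ⇛ x' → z ⇛ z' → app3 (con (case σ τ ρ)) (app (con (c1 a b)) x) y z ⇛ app z' x'
  pfst : x ⇛ x' → app (con (fst σ τ)) (app2 (con (pair a b)) x y) ⇛ x'
  psnd : y ⇛ y' → app (con (snd σ τ)) (app2 (con (pair a b)) x y) ⇛ y'
  ppc0 : y ⇛ y' → app3 (con (pcase σ τ ρ)) (app (con (c0 a b)) x) y z ⇛ y'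
  ppc1 : z ⇛ z' → app3 (con (pcase σ τ ρ)) (app (con (c1 a b)) x) y z ⇛ z'
  pp⊕0 : x ⇛ x' → y ⇛ y' → z ⇛ z' →
    app3 (con (pcase σ τ (ρ₀ ⊕ ρ₁))) x (app (con (c0 ρ₀ ρ₁)) y) (app (con (c0 ρ₀ ρ₁)) z)
      ⇛ app (con (c0 ρ₀ ρ₁)) (app3 (con (pcase σ τ ρ₀)) x' y' z')
  pp⊕1 : x ⇛ x' → y ⇛ y' → z ⇛ z' →
    app3 (con (pcase σ τ (ρ₀ ⊕ ρ₁))) x (app (con (c1 ρ₀ ρ₁)) y) (app (con (c1 ρ₀ ρ₁)) z)
      ⇛ app (con (c1 ρ₀ ρ₁)) (app3 (con (pcase σ τ ρ₁)) x' y' z')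
  pp⊗  : x ⇛ x' → y₁ ⇛ y₁' → y₂ ⇛ y₂' → z₁ ⇛ z₁' → z₂ ⇛ z₂' →
    app3 (con (pcase σ τ (ρ₀ ⊗ ρ₁))) x
         (app2 (con (pair ρ₀ ρ₁)) y₁ y₂) (app2 (con (pair ρ₀ ρ₁)) z₁ z₂)
      ⇛ app2 (con (pair ρ₀ ρ₁)) (app3 (con (pcase σ τ ρ₀)) x' y₁' z₁')
                                (app3 (con (pcase σ τ ρ₁)) x' y₂' z₂')
  pp⇒  : x ⇛ x' → y ⇛ y' → z ⇛ z' → w ⇛ w' →
    app (app3 (con (pcase σ τ (ρ₀ ⇒ ρ₁))) x y z) w
      ⇛ app3 (con (pcase σ τ ρ₁)) x' (app y' w') (app z' w')

⇛-refl : ∀ M → M ⇛ M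
⇛-refl (fv σ n) = pfv
⇛-refl (bv i) = pbv
⇛-refl (con c) = pcon
⇛-refl (app M N) = papp (⇛-refl M) (⇛-refl N)
⇛-refl (lam σ M) = plam (⇛-refl M)

⇛-con₁ : ∀ {k} → x ⇛ x' → app (con k) x ⇛ app (con k) x'
⇛-con₁ = papp pcon

⇛-con₂ : ∀ {k} → x ⇛ x' → y ⇛ y' → app2 (con k) x y ⇛ app2 (con k) x' y'
⇛-con₂ d e = papp (papp pcon d) e

⇛-con₃ : ∀ {k} → x ⇛ x' → y ⇛ y' → z ⇛ z' → app3 (con k) x y z ⇛ app3 (con k) x' y' z'
⇛-con₃ d e f = papp (papp (papp pcon d) e) f

⇛-shift : ∀ c → M ⇛ M' → shift c M ⇛ shift c M'
⇛-shift c pfv = pfv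
⇛-shift c (pbv {i}) = ⇛-refl (shift c (bv i))
⇛-shift c pcon = pcon
⇛-shift c (papp d e) = papp (⇛-shift c d) (⇛-shift c e)
⇛-shift c (plam d) = plam (⇛-shift (suc c) d)
⇛-shift c (pβ {M' = M'} {N' = N'} d e)
  rewrite shift-subst-above {0} {c} N' M' z≤n = pβ (⇛-shift (suc c) d) (⇛-shift c e)
⇛-shift c (pca0 d e) = pca0 (⇛-shift c d) (⇛-shift c e)
⇛-shift c (pca1 d e) = pca1 (⇛-shift c d) (⇛-shift c e)
⇛-shift c (pfst d) = pfst (⇛-shift c d)
⇛-shift c (psnd d) = psnd (⇛-shift c d)
⇛-shift c (ppc0 d) = ppc0 (⇛-shift c d)
⇛-shift c (ppc1 d) = ppc1 (⇛-shift c d)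
⇛-shift c (pp⊕0 d e f) = pp⊕0 (⇛-shift c d) (⇛-shift c e) (⇛-shift c f)
⇛-shift c (pp⊕1 d e f) = pp⊕1 (⇛-shift c d) (⇛-shift c e) (⇛-shift c f)
⇛-shift c (pp⊗ d e f g h) = pp⊗ (⇛-shift c d) (⇛-shift c e) (⇛-shift c f) (⇛-shift c g) (⇛-shift c h)
⇛-shift c (pp⇒ d e f g) = pp⇒ (⇛-shift c d) (⇛-shift c e) (⇛-shift c f) (⇛-shift c g)

-- Substitution is monotone in both arguments w.r.t. ⇛; the β-case is the
-- substitution lemma.  This is what makes the β/β critical pair close.
⇛-subst-bv : ∀ k i → N ⇛ N' → subst k N (bv i) ⇛ subst k N' (bv i)
⇛-subst-bv k i d with i <ᵇ k
... | true = pbv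
... | false with i ≡ᵇ k
...   | true = d
...   | false = pbv

⇛-subst : ∀ k → M ⇛ M' → N ⇛ N' → subst k N M ⇛ subst k N' M'
⇛-subst k pfv e = pfv
⇛-subst k (pbv {i}) e = ⇛-subst-bv k i e
⇛-subst k pcon e = pcon
⇛-subst k (papp d d') e = papp (⇛-subst k d e) (⇛-subst k d' e)
⇛-subst k (plam d) e = plam (⇛-subst (suc k) d (⇛-shift 0 e))
⇛-subst {N' = N'} k (pβ {M' = M'} {N' = A'} d d') e
  rewrite subst-subst {0} {k} N' A' M' z≤n = pβ (⇛-subst (suc k) d (⇛-shift 0 e)) (⇛-subst k d' e)
⇛-subst k (pca0 d d') e = pca0 (⇛-subst k d e) (⇛-subst k d' e)
⇛-subst k (pca1 d d') e = pca1 (⇛-subst k d e) (⇛-subst k d' e)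
⇛-subst k (pfst d) e = pfst (⇛-subst k d e)
⇛-subst k (psnd d) e = psnd (⇛-subst k d e)
⇛-subst k (ppc0 d) e = ppc0 (⇛-subst k d e)
⇛-subst k (ppc1 d) e = ppc1 (⇛-subst k d e)
⇛-subst k (pp⊕0 d f g) e = pp⊕0 (⇛-subst k d e) (⇛-subst k f e) (⇛-subst k g e)
⇛-subst k (pp⊕1 d f g) e = pp⊕1 (⇛-subst k d e) (⇛-subst k f e) (⇛-subst k g e)
⇛-subst k (pp⊗ d f g h i) e = pp⊗ (⇛-subst k d e) (⇛-subst k f e) (⇛-subst k g e) (⇛-subst k h e) (⇛-subst k i e)
⇛-subst k (pp⇒ d f g h) e = pp⇒ (⇛-subst k d e) (⇛-subst k f e) (⇛-subst k g e) (⇛-subst k h e)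

-- Steps using the same rule are joined by
-- joining the subterms; the remaining cases are the critical pairs:
-- β against a reduction inside the abstraction (closed by ⇛-subst), and
-- pcase0/pcase1 against the rules pushing pcase into 0/1, pairs and
-- applications (closed by contracting pcase0/pcase1 on the other side).

mutual
  ⇛-diamond : Diamond _⇛_
  ⇛-diamond (papp d e) f = ⇛-diamond-app d e f
  ⇛-diamond f (papp d e) = joinable-sym {_~_ = _⇛_} (⇛-diamond-app d e f)
  ⇛-diamond pfv pfv = _ , pfv , pfv
  ⇛-diamond pbv pbv = _ , pbv , pbv
  ⇛-diamond pcon pcon = _ , pcon , pcon
  ⇛-diamond (plam d) (plam d') with ⇛-diamond d d'
  ... | _ , n , p = _ , plam n , plam p
  ⇛-diamond (pβ d e) (pβ d' e') with ⇛-diamond d d' | ⇛-diamond e e'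
  ... | _ , n , p | _ , n' , p' = _ , ⇛-subst 0 n n' , ⇛-subst 0 p p'
  ⇛-diamond (pca0 d e) (pca0 d' e') with ⇛-diamond d d' | ⇛-diamond e e'
  ... | _ , n , p | _ , n' , p' = _ , papp n' n , papp p' p
  ⇛-diamond (pca1 d e) (pca1 d' e') with ⇛-diamond d d' | ⇛-diamond e e'
  ... | _ , n , p | _ , n' , p' = _ , papp n' n , papp p' p
  ⇛-diamond (pfst d) (pfst d') = ⇛-diamond d d'
  ⇛-diamond (psnd d) (psnd d') = ⇛-diamond d d'
  ⇛-diamond (ppc0 d) (ppc0 d') = ⇛-diamond d d'
  ⇛-diamond (ppc1 d) (ppc1 d') = ⇛-diamond d d'
  ⇛-diamond (pp⊕0 d e f) (pp⊕0 d' e' f') with ⇛-diamond d d' | ⇛-diamond e e' | ⇛-diamond f f'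
  ... | _ , n₁ , p₁ | _ , n₂ , p₂ | _ , n₃ , p₃ =
    _ , ⇛-con₁ (⇛-con₃ n₁ n₂ n₃) , ⇛-con₁ (⇛-con₃ p₁ p₂ p₃)
  ⇛-diamond (pp⊕1 d e f) (pp⊕1 d' e' f') with ⇛-diamond d d' | ⇛-diamond e e' | ⇛-diamond f f'
  ... | _ , n₁ , p₁ | _ , n₂ , p₂ | _ , n₃ , p₃ =
    _ , ⇛-con₁ (⇛-con₃ n₁ n₂ n₃) , ⇛-con₁ (⇛-con₃ p₁ p₂ p₃)
  ⇛-diamond (pp⊗ d e₁ e₂ f₁ f₂) (pp⊗ d' e₁' e₂' f₁' f₂')
    with ⇛-diamond d d' | ⇛-diamond e₁ e₁' | ⇛-diamond e₂ e₂' | ⇛-diamond f₁ f₁' | ⇛-diamond f₂ f₂'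
  ... | _ , n₁ , p₁ | _ , n₂ , p₂ | _ , n₃ , p₃ | _ , n₄ , p₄ | _ , n₅ , p₅ =
    _ , ⇛-con₂ (⇛-con₃ n₁ n₂ n₄) (⇛-con₃ n₁ n₃ n₅) , ⇛-con₂ (⇛-con₃ p₁ p₂ p₄) (⇛-con₃ p₁ p₃ p₅)
  ⇛-diamond (pp⇒ d e f g) (pp⇒ d' e' f' g')
    with ⇛-diamond d d' | ⇛-diamond e e' | ⇛-diamond f f' | ⇛-diamond g g'
  ... | _ , n₁ , p₁ | _ , n₂ , p₂ | _ , n₃ , p₃ | _ , n₄ , p₄ =
    _ , ⇛-con₃ n₁ (papp n₂ n₄) (papp n₃ n₄) , ⇛-con₃ p₁ (papp p₂ p₄) (papp p₃ p₄)
  -- pcase (0 x) (0 y) (0 z) and pcase (1 x) (c y) (c z) for c = 0, 1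
  ⇛-diamond (ppc0 (papp pcon e)) (pp⊕0 (papp pcon _) e' _) with ⇛-diamond e e'
  ... | _ , n , p = _ , ⇛-con₁ n , ⇛-con₁ (ppc0 p)
  ⇛-diamond (pp⊕0 (papp pcon _) e' _) (ppc0 (papp pcon e)) with ⇛-diamond e' e
  ... | _ , n , p = _ , ⇛-con₁ (ppc0 n) , ⇛-con₁ p
  ⇛-diamond (ppc0 (papp pcon e)) (pp⊕1 (papp pcon _) e' _) with ⇛-diamond e e'
  ... | _ , n , p = _ , ⇛-con₁ n , ⇛-con₁ (ppc0 p)
  ⇛-diamond (pp⊕1 (papp pcon _) e' _) (ppc0 (papp pcon e)) with ⇛-diamond e' e
  ... | _ , n , p = _ , ⇛-con₁ (ppc0 n) , ⇛-con₁ p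
  ⇛-diamond (ppc1 (papp pcon f)) (pp⊕0 (papp pcon _) _ f') with ⇛-diamond f f'
  ... | _ , n , p = _ , ⇛-con₁ n , ⇛-con₁ (ppc1 p)
  ⇛-diamond (pp⊕0 (papp pcon _) _ f') (ppc1 (papp pcon f)) with ⇛-diamond f' f
  ... | _ , n , p = _ , ⇛-con₁ (ppc1 n) , ⇛-con₁ p
  ⇛-diamond (ppc1 (papp pcon f)) (pp⊕1 (papp pcon _) _ f') with ⇛-diamond f f'
  ... | _ , n , p = _ , ⇛-con₁ n , ⇛-con₁ (ppc1 p)
  ⇛-diamond (pp⊕1 (papp pcon _) _ f') (ppc1 (papp pcon f)) with ⇛-diamond f' f
  ... | _ , n , p = _ , ⇛-con₁ (ppc1 n) , ⇛-con₁ p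
  -- pcase (c x) (y₁ , y₂) (z₁ , z₂) for c = 0, 1
  ⇛-diamond (ppc0 (papp (papp pcon e₁) e₂)) (pp⊗ (papp pcon _) e₁' e₂' _ _)
    with ⇛-diamond e₁ e₁' | ⇛-diamond e₂ e₂'
  ... | _ , n₁ , p₁ | _ , n₂ , p₂ = _ , ⇛-con₂ n₁ n₂ , ⇛-con₂ (ppc0 p₁) (ppc0 p₂)
  ⇛-diamond (pp⊗ (papp pcon _) e₁' e₂' _ _) (ppc0 (papp (papp pcon e₁) e₂))
    with ⇛-diamond e₁' e₁ | ⇛-diamond e₂' e₂
  ... | _ , n₁ , p₁ | _ , n₂ , p₂ = _ , ⇛-con₂ (ppc0 n₁) (ppc0 n₂) , ⇛-con₂ p₁ p₂
  ⇛-diamond (ppc1 (papp (papp pcon f₁) f₂)) (pp⊗ (papp pcon _) _ _ f₁' f₂')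
    with ⇛-diamond f₁ f₁' | ⇛-diamond f₂ f₂'
  ... | _ , n₁ , p₁ | _ , n₂ , p₂ = _ , ⇛-con₂ n₁ n₂ , ⇛-con₂ (ppc1 p₁) (ppc1 p₂)
  ⇛-diamond (pp⊗ (papp pcon _) _ _ f₁' f₂') (ppc1 (papp (papp pcon f₁) f₂))
    with ⇛-diamond f₁' f₁ | ⇛-diamond f₂' f₂
  ... | _ , n₁ , p₁ | _ , n₂ , p₂ = _ , ⇛-con₂ (ppc1 n₁) (ppc1 n₂) , ⇛-con₂ p₁ p₂

  ⇛-diamond-app : M ⇛ M' → N ⇛ N' → ∀ {P} → app M N ⇛ P → Joinable _⇛_ (app M' N') P
  ⇛-diamond-app d e (papp d' e') with ⇛-diamond d d' | ⇛-diamond e e'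
  ... | _ , n , p | _ , n' , p' = _ , papp n n' , papp p p'
  ⇛-diamond-app (plam d) e (pβ d' e') with ⇛-diamond d d' | ⇛-diamond e e'
  ... | _ , n , p | _ , n' , p' = _ , pβ n n' , ⇛-subst 0 p p'
  ⇛-diamond-app (papp (papp pcon (papp pcon d)) e) _ (pca0 d' e') with ⇛-diamond d d' | ⇛-diamond e e'
  ... | _ , n , p | _ , n' , p' = _ , pca0 n n' , papp p' p
  ⇛-diamond-app (papp (papp pcon (papp pcon d)) _) f (pca1 d' f') with ⇛-diamond d d' | ⇛-diamond f f'
  ... | _ , n , p | _ , n' , p' = _ , pca1 n n' , papp p' p
  ⇛-diamond-app pcon (papp (papp pcon d) _) (pfst d') with ⇛-diamond d d'
  ... | _ , n , p = _ , pfst n , p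
  ⇛-diamond-app pcon (papp (papp pcon _) e) (psnd e') with ⇛-diamond e e'
  ... | _ , n , p = _ , psnd n , p
  ⇛-diamond-app (papp (papp pcon (papp pcon _)) e) _ (ppc0 e') with ⇛-diamond e e'
  ... | _ , n , p = _ , ppc0 n , p
  ⇛-diamond-app (papp (papp pcon (papp pcon _)) _) f (ppc1 f') with ⇛-diamond f f'
  ... | _ , n , p = _ , ppc1 n , p
  ⇛-diamond-app (papp (papp pcon d) (papp pcon e)) (papp pcon f) (pp⊕0 d' e' f')
    with ⇛-diamond d d' | ⇛-diamond e e' | ⇛-diamond f f'
  ... | _ , n₁ , p₁ | _ , n₂ , p₂ | _ , n₃ , p₃ = _ , pp⊕0 n₁ n₂ n₃ , ⇛-con₁ (⇛-con₃ p₁ p₂ p₃)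
  ⇛-diamond-app (papp (papp pcon d) (papp pcon e)) (papp pcon f) (pp⊕1 d' e' f')
    with ⇛-diamond d d' | ⇛-diamond e e' | ⇛-diamond f f'
  ... | _ , n₁ , p₁ | _ , n₂ , p₂ | _ , n₃ , p₃ = _ , pp⊕1 n₁ n₂ n₃ , ⇛-con₁ (⇛-con₃ p₁ p₂ p₃)
  ⇛-diamond-app (papp (papp pcon d) (papp (papp pcon e₁) e₂)) (papp (papp pcon f₁) f₂)
                (pp⊗ d' e₁' e₂' f₁' f₂')
    with ⇛-diamond d d' | ⇛-diamond e₁ e₁' | ⇛-diamond e₂ e₂' | ⇛-diamond f₁ f₁' | ⇛-diamond f₂ f₂'
  ... | _ , n₁ , p₁ | _ , n₂ , p₂ | _ , n₃ , p₃ | _ , n₄ , p₄ | _ , n₅ , p₅ =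
    _ , pp⊗ n₁ n₂ n₃ n₄ n₅ , ⇛-con₂ (⇛-con₃ p₁ p₂ p₄) (⇛-con₃ p₁ p₃ p₅)
  ⇛-diamond-app (papp (papp (papp pcon d) e) f) g (pp⇒ d' e' f' g')
    with ⇛-diamond d d' | ⇛-diamond e e' | ⇛-diamond f f' | ⇛-diamond g g'
  ... | _ , n₁ , p₁ | _ , n₂ , p₂ | _ , n₃ , p₃ | _ , n₄ , p₄ =
    _ , pp⇒ n₁ n₂ n₃ n₄ , ⇛-con₃ p₁ (papp p₂ p₄) (papp p₃ p₄)
  -- (pcase (c x) y z) w for c = 0, 1
  ⇛-diamond-app (ppc0 e) g (pp⇒ (papp pcon _) e' _ g') with ⇛-diamond e e' | ⇛-diamond g g'
  ... | _ , n₂ , p₂ | _ , n₄ , p₄ = _ , papp n₂ n₄ , ppc0 (papp p₂ p₄)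
  ⇛-diamond-app (ppc1 f) g (pp⇒ (papp pcon _) _ f' g') with ⇛-diamond f f' | ⇛-diamond g g'
  ... | _ , n₃ , p₃ | _ , n₄ , p₄ = _ , papp n₃ n₄ , ppc1 (papp p₃ p₄)

⟶⇒⇛ : M ⟶ N → M ⇛ N
⟶⇒⇛ (β {M = M} {N = N}) = pβ (⇛-refl M) (⇛-refl N)
⟶⇒⇛ (appˡ {N = N} s) = papp (⟶⇒⇛ s) (⇛-refl N)
⟶⇒⇛ (appʳ {M = M} s) = papp (⇛-refl M) (⟶⇒⇛ s)
⟶⇒⇛ (lamc s) = plam (⟶⇒⇛ s)
⟶⇒⇛ (case0 {x = x} {y = y}) = pca0 (⇛-refl x) (⇛-refl y)
⟶⇒⇛ (case1 {x = x} {z = z}) = pca1 (⇛-refl x) (⇛-refl z)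
⟶⇒⇛ (fstp {x = x}) = pfst (⇛-refl x)
⟶⇒⇛ (sndp {y = y}) = psnd (⇛-refl y)
⟶⇒⇛ (pcase0 {y = y}) = ppc0 (⇛-refl y)
⟶⇒⇛ (pcase1 {z = z}) = ppc1 (⇛-refl z)
⟶⇒⇛ (pcase⊕0 {x = x} {y = y} {z = z}) = pp⊕0 (⇛-refl x) (⇛-refl y) (⇛-refl z)
⟶⇒⇛ (pcase⊕1 {x = x} {y = y} {z = z}) = pp⊕1 (⇛-refl x) (⇛-refl y) (⇛-refl z)
⟶⇒⇛ (pcase⊗ {x = x} {y₁ = y₁} {y₂ = y₂} {z₁ = z₁} {z₂ = z₂}) =
  pp⊗ (⇛-refl x) (⇛-refl y₁) (⇛-refl y₂) (⇛-refl z₁) (⇛-refl z₂)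
⟶⇒⇛ (pcase⇒ {x = x} {y = y} {z = z} {w = w}) = pp⇒ (⇛-refl x) (⇛-refl y) (⇛-refl z) (⇛-refl w)

infixl 9 _·*_
_·*_ : ∀ {M M' N N'} → M ⟶* M' → N ⟶* N' → app M N ⟶* app M' N'
_·*_ {M' = M'} {N = N} ms ns = gmap (λ P → app P N) appˡ ms ◅◅ gmap (app M') appʳ ns

lam* : ∀ {σ M M'} → M ⟶* M' → lam σ M ⟶* lam σ M'
lam* {σ} = gmap (lam σ) lamc

⇛⇒⟶* : M ⇛ N → M ⟶* N
⇛⇒⟶* pfv = ε
⇛⇒⟶* pbv = ε
⇛⇒⟶* pcon = ε
⇛⇒⟶* (papp d e) = ⇛⇒⟶* d ·* ⇛⇒⟶* e
⇛⇒⟶* (plam d) = lam* (⇛⇒⟶* d)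
⇛⇒⟶* (pβ d e) = lam* (⇛⇒⟶* d) ·* ⇛⇒⟶* e ◅◅ return β
⇛⇒⟶* (pca0 d e) = ε ·* (ε ·* ⇛⇒⟶* d) ·* ⇛⇒⟶* e ·* ε ◅◅ return case0
⇛⇒⟶* (pca1 d e) = ε ·* (ε ·* ⇛⇒⟶* d) ·* ε ·* ⇛⇒⟶* e ◅◅ return case1
⇛⇒⟶* (pfst d) = ε ·* (ε ·* ⇛⇒⟶* d ·* ε) ◅◅ return fstp
⇛⇒⟶* (psnd e) = ε ·* (ε ·* ε ·* ⇛⇒⟶* e) ◅◅ return sndp
⇛⇒⟶* (ppc0 e) = ε ·* ε ·* ⇛⇒⟶* e ·* ε ◅◅ return pcase0
⇛⇒⟶* (ppc1 f) = ε ·* ε ·* ε ·* ⇛⇒⟶* f ◅◅ return pcase1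
⇛⇒⟶* (pp⊕0 d e f) = ε ·* ⇛⇒⟶* d ·* (ε ·* ⇛⇒⟶* e) ·* (ε ·* ⇛⇒⟶* f) ◅◅ return pcase⊕0
⇛⇒⟶* (pp⊕1 d e f) = ε ·* ⇛⇒⟶* d ·* (ε ·* ⇛⇒⟶* e) ·* (ε ·* ⇛⇒⟶* f) ◅◅ return pcase⊕1
⇛⇒⟶* (pp⊗ d e₁ e₂ f₁ f₂) =
  ε ·* ⇛⇒⟶* d ·* (ε ·* ⇛⇒⟶* e₁ ·* ⇛⇒⟶* e₂) ·* (ε ·* ⇛⇒⟶* f₁ ·* ⇛⇒⟶* f₂) ◅◅ return pcase⊗
⇛⇒⟶* (pp⇒ d e f g) = ε ·* ⇛⇒⟶* d ·* ⇛⇒⟶* e ·* ⇛⇒⟶* f ·* ⇛⇒⟶* g ◅◅ return pcase⇒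

⟶-confluent : Confluent _⟶_
⟶-confluent = confluent-between ⟶⇒⇛ ⇛⇒⟶* (diamond⇒confluent ⇛-diamond)

mainTheorem3 : ∀ (M N P : Tm) → Typed M → M ⟶* N → M ⟶* P →
    ∃[ Q ] (N ⟶* Q × P ⟶* Q)
mainTheorem3 M N P _ = ⟶-confluent
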